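{- Let $\mathbb F$ be a field, $\mathcal A_k$ a $k$-dimensional $\mathbb F$-algebra, and $A(\mathbf x)\in\mathcal A_k[x_1,\dots,x_n]$ a polynomial of individual degree at most $d$. Let $\mathrm w:[n]\to\mathbb N$ be a basis isolating weight assignment for $A(\mathbf x)$. Then $A(\mathbf x+t^{\mathrm w})=A(x_1+t^{\mathrm w(1)},\dots,x_n+t^{\mathrm w(n)})$ is $\ell$-concentrated, where $\ell=\lceil\log(k+1)\rceil$.
   Context: Let $M=\{0,1,\dots,d\}^n$. For $\mathrm w:[n]\to\mathbb N$ and $\mathbf a\in M$, $\mathrm w(\mathbf a)=\sum_i\mathrm w(i)a_i$. $\mathrm w$ is a basis isolating weight assignment for $A\in\mathcal A_k[\mathbf x]$ if there is $S\subseteq M$ with $|S|\le k$ such that (i) $\mathrm w(\mathbf a)\ne\mathrm w(\mathbf b)$ for all distinct $\mathbf a,\mathbf b\in S$, and (ii) for all $\mathbf a\in M\setminus S$, $\mathrm{coeff}_A(\mathbf x^{\mathbf a})\in\mathrm{Span}_{\mathbb F}\{\mathrm{coeff}_A(\mathbf x^{\mathbf b})\mid\mathbf b\in S,\ \mathrm w(\mathbf b)<\mathrm w(\mathbf a)\}$. For $\mathbf a\in\mathbb N^n$, $\mathrm{supp}(\mathbf a)=|\{i:a_i\ne0\}|$. A polynomial $A'(\mathbf x)$ with coefficients in $\mathcal A_k\otimes\mathbb F[t]$ is $\ell$-concentrated if every coefficient $\mathrm{coeff}_{A'}(\mathbf x^{\mathbf a})$ lies in the $\mathbb F(t)$-span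 of $\{\mathrm{coeff}_{A'}(\mathbf x^{\mathbf b})\mid\mathrm{supp}(\mathbf b)<\ell\}$. $\log$ is base 2. -}

module Defs where

open import Level using (Level; _⊔_)
open import Algebra.Bundles using (CommutativeRing)
open import Data.Bool using (Bool; true; false; _∧_; if_then_else_)
open import Data.Nat as ℕ using (ℕ; zero; suc; _<_; _≤_; _<?_; _≤ᵇ_; _≡ᵇ_)
open import Data.Nat.Combinatorics using (_C_)
open import Data.Fin as Fin using (Fin; toℕ)
open import Data.Vec using (Vec; []; _∷_)
open import Data.List as List using (List; []; _∷_; [_]; length; concatMap; map; filter; allFin)
open import Data.List.Relation.Unary.Unique.Propositional using (Unique)
open import Data.List.Membership.Propositional using (_∈_; _∉_)
open import Data.Product using (Σ; Σ-syntax; ∃; ∃-syntax; _×_)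
open import Relation.Nullary using (¬_)
open import Relation.Binary.PropositionalEquality using (_≡_; _≢_)

record Field (c ℓ : Level) : Set (Level.suc (c ⊔ ℓ)) where
  field
    commutativeRing : CommutativeRing c ℓ
  open CommutativeRing commutativeRing public
  field
    0≉1     : ¬ (0# ≈ 1#)
    inverse : ∀ x → ¬ (x ≈ 0#) → ∃[ y ] (x * y ≈ 1#)

-- Exponent vectors: M = {0,…,d}^n, an entry i ∈ Fin (suc d) stands for toℕ i.
Exp : ℕ → ℕ → Set
Exp n d = Vec (Fin (suc d)) n

allExp : ∀ n d → List (Exp n d)
allExp zero    d = [ [] ]
allExp (suc n) d = concatMap (λ i → map (i ∷_) (allExp n d)) (allFin (suc d))

wt : ∀ {n d} → (Fin n → ℕ) → Exp n d → ℕ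
wt w []       = 0
wt w (x ∷ a)  = w Fin.zero ℕ.* toℕ x ℕ.+ wt (λ i → w (Fin.suc i)) a

supp : ∀ {n d} → Exp n d → ℕ
supp []            = 0
supp (Fin.zero ∷ a) = supp a
supp (Fin.suc _ ∷ a) = suc (supp a)

dominates : ∀ {n d} → Exp n d → Exp n d → Bool
dominates []       []       = true
dominates (x ∷ a)  (y ∷ b)  = (toℕ y ≤ᵇ toℕ x) ∧ dominates a b

module _ {c ℓ} (F : Field c ℓ) where
  open Field F using (Carrier; _≈_; _+_; _*_; 0#; 1#)

  ι : ℕ → Carrier
  ι zero    = 0#
  ι (suc m) = 1# + ι m

  sumF : List Carrier → Carrier
  sumF []       = 0#
  sumF (x ∷ xs) = x + sumF xs

  binomProd : ∀ {n d} → Exp n d → Exp n d → Carrier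
  binomProd []      []      = 1#
  binomProd (x ∷ a) (y ∷ b) = ι (toℕ x C toℕ y) * binomProd a b

  -- The k-dimensional F-algebra A_k, as an F-vector space: A_k ≅ F^k
  -- (coordinates w.r.t. a fixed basis).
  Alg : ℕ → Set c
  Alg k = Fin k → Carrier

  -- A(x) ∈ A_k[x_1,…,x_n] of individual degree ≤ d, given by its coefficients
  Poly : ℕ → ℕ → ℕ → Set c
  Poly k n d = Exp n d → Alg k

  sumAlg : ∀ {k} {X : Set} → List X → (X → Alg k) → Alg k
  sumAlg []       f j = 0#
  sumAlg (x ∷ xs) f j = f x j + sumAlg xs f j

  IsBasisIsolating : ∀ {k n d} → Poly k n d → (Fin n → ℕ) → Set (c ⊔ ℓ)
  IsBasisIsolating {k} {n} {d} A w =
    Σ[ S ∈ List (Exp n d) ]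
      ( Unique S
      × length S ≤ k
      × (∀ {a b} → a ∈ S → b ∈ S → a ≢ b → wt w a ≢ wt w b)
      × (∀ a → a ∉ S →
           Σ[ λs ∈ (Exp n d → Carrier) ]
             (∀ j → A a j ≈
                sumAlg (filter (λ b → wt w b <? wt w a) S) (λ b i → λs b * A b i) j)))

  -- Elements of A_k ⊗ F[t]: m ↦ (coefficient of t^m) ∈ A_k.
  TAlg : ℕ → Set c
  TAlg k = ℕ → Alg k

  -- Univariate polynomials in F[t]: coefficient lists (constant term first).
  coeffT : List Carrier → ℕ → Carrier
  coeffT []       m       = 0#
  coeffT (p ∷ ps) zero    = p
  coeffT (p ∷ ps) (suc m) = coeffT ps m

  _•_ : ∀ {k} → List Carrier → TAlg k → TAlg k
  ([]     • v) m       j = 0#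
  ((p ∷ ps) • v) zero    j = p * v zero j
  ((p ∷ ps) • v) (suc m) j = p * v (suc m) j + (ps • v) m j

  sumT : ∀ {k} {X : Set} → List X → (X → TAlg k) → TAlg k
  sumT []       f m j = 0#
  sumT (x ∷ xs) f m j = f x m j + sumT xs f m j

  -- v lies in the F(t)-span of {vs b | b ∈ B}: after clearing denominators,
  -- q·v = Σ_b λ_b · vs b for some nonzero q ∈ F[t] and λ_b ∈ F[t].
  InFtSpan : ∀ {k} {X : Set} → TAlg k → List X → (X → TAlg k) → Set (c ⊔ ℓ)
  InFtSpan {k} {X} v B vs =
    Σ[ q ∈ List Carrier ] ((∃[ i ] ¬ (coeffT q i ≈ 0#)) ×
      Σ[ λs ∈ (X → List Carrier) ]
        (∀ m j → (q • v) m j ≈ sumT B (λ b → λs b • vs b) m j))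

  -- A'(x) = A(x + t^w): coefficient of x^b t^m is
  --   Σ_{a ∈ M, a ≥ b, w(a) = w(b) + m} Π_i binom(a_i,b_i) · coeff_A(x^a),
  -- i.e. the expansion of Σ_a coeff_A(x^a) Π_i (x_i + t^{w(i)})^{a_i}.
  shift : ∀ {k n d} → Poly k n d → (Fin n → ℕ) → Exp n d → TAlg k
  shift {k} {n} {d} A w b m j =
    sumF (map (λ a → if dominates a b ∧ (wt w a ≡ᵇ (wt w b ℕ.+ m))
                      then binomProd a b * A a j
                      else 0#)
              (allExp n d))

  IsConcentrated : ∀ {k n d} → ℕ → (Exp n d → TAlg k) → Set (c ⊔ ℓ)
  IsConcentrated {k} {n} {d} L A' =
    ∀ a → InFtSpan (A' a) (filter (λ b → supp b <? L) (allExp n d)) A'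

{-# OPTIONS --safe #-}
-- Write E(a) = coeff_A(x^a) t^w(a) ∈ A_k ⊗ F[t] and A′ = A(x + t^w).  Expanding Π_i (x_i + t^w(i))^a_i
-- gives t^w(b) · coeff_A′(x^b) = Σ_a binom(a,b) E(a).  Basis isolation writes every E(a) as an
-- F[t]-combination of the E(s), s ∈ S, whose coefficient matrix is the identity modulo t.
-- Since |S| ≤ k < 2^ℓ, for every s there is N_s supported on exponents of support < ℓ with
-- Σ_y N_s(y) binom(x,y) = δ(s,x) for all x ∈ S: induct on the number of variables, splitting S into
-- fibres over the first coordinate, at most one of which has ≥ 2^(ℓ-1) elements.  The vectors
-- U(s) = Σ_y N_s(y) t^w(y) coeff_A′(x^y) lie in the span of the low-support coefficients of A′, and by
-- the two facts above they are combinations of the E(s) whose matrix is again the identity modulo t.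
-- Gaussian elimination over F[t], whose pivots are ≡ 1 (mod t), yields q ≡ 1 (mod t) with every q E(s)
-- in the F[t]-span of the U(s).  Hence t^w(b) q coeff_A′(x^b) lies in the span of the low-support
-- coefficients, and t^w(b) q ≠ 0 because its coefficient of t^w(b) is 1.  No division occurs: of the
-- field axioms only 0 ≠ 1 is used.
module Submission where

open import Algebra.Bundles using (CommutativeMonoid; AbelianGroup; CommutativeRing)
import Algebra.Construct.Pointwise as Pointwise
open import Data.Bool using (true; false; if_then_else_; _∧_; T)
open import Data.Empty using (⊥-elim)
open import Data.Fin using (Fin; zero; suc; toℕ)
import Data.Fin.Properties as Fin
open import Data.Fin.Instances
open import Data.List using (List; []; _∷_; _++_; map; concatMap; filter; allFin; length; cartesianProductWith)
open import Data.List.Properties using (map-tabulate)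
open import Data.List.Membership.Propositional using (_∈_; _∉_)
open import Data.List.Membership.Propositional.Properties using (∈-allFin; ∈-cartesianProductWith⁺)
open import Data.List.Relation.Unary.All as All using (All; [])
open import Data.List.Relation.Unary.AllPairs using ([]; _∷_)
open import Data.List.Relation.Unary.Any using (here; there)
open import Data.List.Relation.Unary.Unique.Propositional using (Unique)
open import Data.List.Relation.Unary.Unique.Propositional.Properties using (allFin⁺; cartesianProductWith⁺)
open import Data.Nat as ℕ using (ℕ; zero; suc; z≤n; s≤s)
open import Data.Nat.Combinatorics using (_C_; nCk+nC[k+1]≡[n+1]C[k+1])
open import Data.Nat.Induction using (<-wellFounded)
open import Data.Nat.Instances
open import Data.Nat.Logarithm using (⌈log₂_⌉)
open import Data.Nat.Logarithm.Core using (⌈log2⌉)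
import Data.Nat.Properties as ℕ
open import Data.Product using (Σ-syntax; _×_; _,_; proj₁; proj₂; ∃-syntax)
open import Data.Vec using ([]; _∷_)
open import Data.Vec.Instances
import Data.Vec.Properties as Vec
open import Function using (_∘_)
open import Induction.WellFounded using (Acc; acc)
open import Level using (_⊔_)
open import Relation.Binary.PropositionalEquality as ≡ using (_≡_; _≢_)
import Relation.Binary.Reasoning.Setoid
open import Relation.Binary.Structures using (IsDecEquivalence)
open import Relation.Binary.TypeClasses using (_≟_)
open import Relation.Nullary using (Dec; yes; no; does; ¬_)
open import Relation.Nullary.Decidable using (dec-true; dec-false)
open import Relation.Unary using (Pred; Decidable)

open import Defs

≡ᵇ-+ : ∀ N a b → (N ℕ.+ a ℕ.≡ᵇ N ℕ.+ b) ≡ (a ℕ.≡ᵇ b)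
≡ᵇ-+ zero    a b = ≡.refl
≡ᵇ-+ (suc N) a b = ≡ᵇ-+ N a b

n≤2*⌈n/2⌉ : ∀ n → n ℕ.≤ 2 ℕ.* ℕ.⌈ n /2⌉
n≤2*⌈n/2⌉ 0             = z≤n
n≤2*⌈n/2⌉ 1             = s≤s z≤n
n≤2*⌈n/2⌉ (suc (suc n)) =
  ℕ.≤-trans (s≤s (s≤s (n≤2*⌈n/2⌉ n))) (ℕ.≤-reflexive (≡.cong suc (≡.sym (ℕ.+-suc _ _))))

n≤2^⌈log2⌉n : ∀ n (acc : Acc ℕ._<_ n) → n ℕ.≤ 2 ℕ.^ ⌈log2⌉ n acc
n≤2^⌈log2⌉n 0             _        = z≤n
n≤2^⌈log2⌉n 1             _        = s≤s z≤n
n≤2^⌈log2⌉n (suc (suc n)) (acc rs) =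
  ℕ.≤-trans (n≤2*⌈n/2⌉ (suc (suc n))) (ℕ.*-monoʳ-≤ 2 (n≤2^⌈log2⌉n _ (rs (ℕ.⌈n/2⌉<n n))))

n≤2^⌈log₂n⌉ : ∀ n → n ℕ.≤ 2 ℕ.^ ⌈log₂ n ⌉
n≤2^⌈log₂n⌉ n = n≤2^⌈log2⌉n n (<-wellFounded n)

-- Finite sums

module ListSum {a ℓ} (M : CommutativeMonoid a ℓ) where
  open CommutativeMonoid M
  open import Algebra.Properties.CommutativeSemigroup commutativeSemigroup using (interchange)
  open import Relation.Binary.Reasoning.Setoid setoid

  ∑ : {X : Set} → List X → (X → Carrier) → Carrier
  ∑ []       f = ε
  ∑ (x ∷ xs) f = f x ∙ ∑ xs f

  private variable X Y : Set

  ∑-cong-∈ : ∀ (L : List X) {f g : X → Carrier} → (∀ {x} → x ∈ L → f x ≈ g x) → ∑ L f ≈ ∑ L g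
  ∑-cong-∈ []      f≈g = refl
  ∑-cong-∈ (x ∷ L) f≈g = ∙-cong (f≈g (here ≡.refl)) (∑-cong-∈ L (f≈g ∘ there))

  ∑-cong : ∀ (L : List X) {f g : X → Carrier} → (∀ x → f x ≈ g x) → ∑ L f ≈ ∑ L g
  ∑-cong L f≈g = ∑-cong-∈ L (λ {x} _ → f≈g x)

  ∑-ε : ∀ (L : List X) → ∑ L (λ _ → ε) ≈ ε
  ∑-ε []      = refl
  ∑-ε (x ∷ L) = trans (identityˡ _) (∑-ε L)

  ∑-vanishing : ∀ (L : List X) {f : X → Carrier} → (∀ {x} → x ∈ L → f x ≈ ε) → ∑ L f ≈ ε
  ∑-vanishing L f≈ε = trans (∑-cong-∈ L f≈ε) (∑-ε L)

  ∑-distrib : ∀ (L : List X) (f g : X → Carrier) → ∑ L (λ x → f x ∙ g x) ≈ ∑ L f ∙ ∑ L g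
  ∑-distrib []      f g = sym (identityˡ ε)
  ∑-distrib (x ∷ L) f g = trans (∙-cong refl (∑-distrib L f g)) (interchange _ _ _ _)

  ∑-comm : ∀ (L : List X) (K : List Y) (f : X → Y → Carrier) →
           ∑ L (λ x → ∑ K (f x)) ≈ ∑ K (λ y → ∑ L (λ x → f x y))
  ∑-comm []      K f = sym (∑-ε K)
  ∑-comm (x ∷ L) K f = begin
    ∑ K (f x) ∙ ∑ L (λ x′ → ∑ K (f x′))          ≈⟨ ∙-cong refl (∑-comm L K f) ⟩
    ∑ K (f x) ∙ ∑ K (λ y → ∑ L (λ x′ → f x′ y))  ≈⟨ ∑-distrib K (f x) _ ⟨
    ∑ K (λ y → f x y ∙ ∑ L (λ x′ → f x′ y))      ∎

  ∑-++ : ∀ (L K : List X) (f : X → Carrier) → ∑ (L ++ K) f ≈ ∑ L f ∙ ∑ K f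
  ∑-++ []      K f = sym (identityˡ _)
  ∑-++ (x ∷ L) K f = trans (∙-cong refl (∑-++ L K f)) (sym (assoc _ _ _))

  ∑-map : ∀ (g : X → Y) (L : List X) (f : Y → Carrier) → ∑ (map g L) f ≡ ∑ L (f ∘ g)
  ∑-map g []      f = ≡.refl
  ∑-map g (x ∷ L) f = ≡.cong (f (g x) ∙_) (∑-map g L f)

  ∑-concatMap : ∀ (h : X → List Y) (L : List X) (f : Y → Carrier) →
                ∑ (concatMap h L) f ≈ ∑ L (λ x → ∑ (h x) f)
  ∑-concatMap h []      f = refl
  ∑-concatMap h (x ∷ L) f = trans (∑-++ (h x) (concatMap h L) f) (∙-cong refl (∑-concatMap h L f))

  ∑-filter : ∀ {p} {P : Pred X p} (P? : Decidable P) (L : List X) (f : X → Carrier) →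
             ∑ (filter P? L) f ≈ ∑ L (λ x → if does (P? x) then f x else ε)
  ∑-filter P? []      f = refl
  ∑-filter P? (x ∷ L) f with does (P? x)
  ... | true  = ∙-cong refl (∑-filter P? L f)
  ... | false = trans (∑-filter P? L f) (sym (identityˡ _))

  ∑-pick : {X : Set} {{_ : IsDecEquivalence {A = X} _≡_}} {L : List X} → Unique L → ∀ {s} → s ∈ L →
           (f : X → Carrier) → ∑ L (λ x → if does (x ≟ s) then f x else ε) ≈ f s
  ∑-pick {X} uL {s} s∈L f = go uL s∈L
    where
      pick : X → Carrier
      pick x = if does (x ≟ s) then f x else ε
      on : pick s ≈ f s
      on = reflexive (≡.cong (λ b → if b then f s else ε) (dec-true (s ≟ s) ≡.refl))
      off : ∀ {x} → x ≢ s → pick x ≈ ε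
      off {x} x≢s = reflexive (≡.cong (λ b → if b then f x else ε) (dec-false (x ≟ s) x≢s))
      go : ∀ {L} → Unique L → s ∈ L → ∑ L pick ≈ f s
      go (x∉L ∷ _)  (here ≡.refl) = trans (∙-cong on (∑-vanishing _ (off ∘ ≡.≢-sym ∘ All.lookup x∉L))) (identityʳ _)
      go (x∉L ∷ uL) (there s∈L)  = trans (∙-cong (off (All.lookup x∉L s∈L)) (go uL s∈L)) (identityˡ _)

  ∑-allFin-suc : ∀ n (f : Fin (suc n) → Carrier) → ∑ (allFin (suc n)) f ≡ f zero ∙ ∑ (allFin n) (f ∘ suc)
  ∑-allFin-suc n f = ≡.cong (f zero ∙_)
    (≡.trans (≡.cong (λ L → ∑ L f) (≡.sym (map-tabulate (λ i → i) suc))) (∑-map suc (allFin n) f))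

module ListSumHom {a b ℓ₁ ℓ₂} (M : CommutativeMonoid a ℓ₁) (N : CommutativeMonoid b ℓ₂) where
  private
    module M = CommutativeMonoid M
    module N = CommutativeMonoid N
  open ListSum M using () renaming (∑ to ∑ᴹ)
  open ListSum N using () renaming (∑ to ∑ᴺ)

  ∑-hom : (h : M.Carrier → N.Carrier) → h M.ε N.≈ N.ε → (∀ x y → h (x M.∙ y) N.≈ h x N.∙ h y) →
          ∀ {X : Set} (L : List X) (f : X → M.Carrier) → h (∑ᴹ L f) N.≈ ∑ᴺ L (h ∘ f)
  ∑-hom h h-ε h-∙ []      f = h-ε
  ∑-hom h h-ε h-∙ (x ∷ L) f = N.trans (h-∙ _ _) (N.∙-cong N.refl (∑-hom h h-ε h-∙ L f))

module RingSums {c ℓ} (R : CommutativeRing c ℓ) where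
  open CommutativeRing R
  open ListSum +-commutativeMonoid
  open ListSumHom +-commutativeMonoid +-commutativeMonoid using (∑-hom)

  ∑-*ˡ : ∀ {X : Set} a (L : List X) f → a * ∑ L f ≈ ∑ L (λ x → a * f x)
  ∑-*ˡ a = ∑-hom (a *_) (zeroʳ a) (distribˡ a)

  ∑-*ʳ : ∀ {X : Set} a (L : List X) f → ∑ L f * a ≈ ∑ L (λ x → f x * a)
  ∑-*ʳ a = ∑-hom (_* a) (zeroˡ a) (λ x y → distribʳ a x y)

  module _ {X : Set} {{_ : IsDecEquivalence {A = X} _≡_}} where

    δ : X → X → Carrier
    δ x y = if does (x ≟ y) then 1# else 0#

    δ-refl : ∀ x → δ x x ≈ 1#
    δ-refl x = reflexive (≡.cong (λ b → if b then 1# else 0#) (dec-true (x ≟ x) ≡.refl))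

    δ-≢ : ∀ {x y} → x ≢ y → δ x y ≈ 0#
    δ-≢ {x} {y} x≢y = reflexive (≡.cong (λ b → if b then 1# else 0#) (dec-false (x ≟ y) x≢y))

    δ-sym : ∀ x y → δ x y ≡ δ y x
    δ-sym x y with x ≟ y | y ≟ x
    ... | yes _   | yes _   = ≡.refl
    ... | no _    | no _    = ≡.refl
    ... | yes x≡y | no y≢x  = ⊥-elim (y≢x (≡.sym x≡y))
    ... | no x≢y  | yes y≡x = ⊥-elim (x≢y (≡.sym y≡x))

    *δ : ∀ a x y → a * δ x y ≈ (if does (x ≟ y) then a else 0#)
    *δ a x y with does (x ≟ y)
    ... | true  = *-identityʳ a
    ... | false = zeroʳ a

    ∑-δ : ∀ {L : List X} → Unique L → ∀ {s} → s ∈ L → (f : X → Carrier) → ∑ L (λ x → f x * δ x s) ≈ f s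
    ∑-δ {L} uL {s} s∈L f = trans (∑-cong L (λ x → *δ (f x) x s)) (∑-pick uL s∈L f)

-- Exponent vectors

concatMap≡cartesianProductWith : ∀ {A B C : Set} (f : A → B → C) (xs : List A) (ys : List B) →
                                 concatMap (λ x → map (f x) ys) xs ≡ cartesianProductWith f xs ys
concatMap≡cartesianProductWith f []       ys = ≡.refl
concatMap≡cartesianProductWith f (x ∷ xs) ys = ≡.cong (map (f x) ys ++_) (concatMap≡cartesianProductWith f xs ys)

allExp-unique : ∀ n d → Unique (allExp n d)
allExp-unique zero    d = [] ∷ []
allExp-unique (suc n) d =
  ≡.subst Unique (≡.sym (concatMap≡cartesianProductWith _∷_ (allFin (suc d)) (allExp n d)))
    (cartesianProductWith⁺ _∷_ Vec.∷-injective (allFin⁺ (suc d)) (allExp-unique n d))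

∈-allExp : ∀ {n d} (x : Exp n d) → x ∈ allExp n d
∈-allExp []              = here ≡.refl
∈-allExp {d = d} (i ∷ x) =
  ≡.subst (i ∷ x ∈_) (≡.sym (concatMap≡cartesianProductWith _∷_ (allFin (suc d)) (allExp _ d)))
    (∈-cartesianProductWith⁺ _∷_ (∈-allFin i) (∈-allExp x))

dominates⇒wt≤ : ∀ {n d} (w : Fin n → ℕ) (a b : Exp n d) → dominates a b ≡ true → wt w b ℕ.≤ wt w a
dominates⇒wt≤ w []      []      _ = z≤n
dominates⇒wt≤ w (x ∷ a) (y ∷ b) dom with toℕ y ℕ.≤ᵇ toℕ x in y≤ᵇx
dominates⇒wt≤ w (x ∷ a) (y ∷ b) dom | true =
  ℕ.+-mono-≤ (ℕ.*-monoʳ-≤ (w zero) (ℕ.≤ᵇ⇒≤ (toℕ y) (toℕ x) (≡.subst T (≡.sym y≤ᵇx) _)))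
             (dominates⇒wt≤ (w ∘ suc) a b dom)

fibre : ∀ {n d} → Fin (suc d) → List (Exp (suc n) d) → List (Exp n d)
fibre c []            = []
fibre c ((j ∷ y) ∷ S) = if does (j ≟ c) then y ∷ fibre c S else fibre c S

fibre-length : ∀ {n d} c (S : List (Exp (suc n) d)) → length (fibre c S) ℕ.≤ length S
fibre-length c []            = z≤n
fibre-length c ((j ∷ y) ∷ S) with does (j ≟ c)
... | true  = s≤s (fibre-length c S)
... | false = ℕ.m≤n⇒m≤1+n (fibre-length c S)

fibres-length : ∀ {n d} {c c′ : Fin (suc d)} → c ≢ c′ → (S : List (Exp (suc n) d)) →
                length (fibre c S) ℕ.+ length (fibre c′ S) ℕ.≤ length S
fibres-length c≢c′ []                        = z≤n
fibres-length {c = c} {c′} c≢c′ ((j ∷ y) ∷ S) with j ≟ c | j ≟ c′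
... | yes ≡.refl | yes ≡.refl = ⊥-elim (c≢c′ ≡.refl)
... | yes _      | no _       = s≤s (fibres-length c≢c′ S)
... | no _       | yes _      = ≡.subst (ℕ._≤ suc (length S)) (≡.sym (ℕ.+-suc _ _)) (s≤s (fibres-length c≢c′ S))
... | no _       | no _       = ℕ.m≤n⇒m≤1+n (fibres-length c≢c′ S)

∈-fibre : ∀ {n d} {c : Fin (suc d)} {y : Exp n d} (S : List (Exp (suc n) d)) → (c ∷ y) ∈ S → y ∈ fibre c S
∈-fibre {c = c} ((j ∷ y) ∷ S) (here ≡.refl) with c ≟ c
... | yes _  = here ≡.refl
... | no c≢c = ⊥-elim (c≢c ≡.refl)
∈-fibre {c = c} ((j ∷ y) ∷ S) (there c∷y∈S) with does (j ≟ c)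
... | true  = there (∈-fibre S c∷y∈S)
... | false = ∈-fibre S c∷y∈S

at-most-one-large-fibre : ∀ {n d} L (S : List (Exp (suc n) d)) → length S ℕ.< 2 ℕ.^ suc L →
                          Σ[ c* ∈ Fin (suc d) ] (∀ c → c ≢ c* → length (fibre c S) ℕ.< 2 ℕ.^ L)
at-most-one-large-fibre L S |S|< with Fin.any? (λ c → 2 ℕ.^ L ℕ.≤? length (fibre c S))
... | no none           = zero , λ c _ → ℕ.≰⇒> (λ large → none (c , large))
... | yes (c* , large*) = c* , λ c c≢c* → ℕ.≰⇒> λ large → ℕ.<⇒≱ |S|<
  (ℕ.≤-trans (ℕ.+-mono-≤ large (ℕ.≤-trans (ℕ.≤-reflexive (ℕ.+-identityʳ _)) large*)) (fibres-length c≢c* S))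

-- Interpolation by functionals of low support

module Interpolation {c ℓ} (F : Field c ℓ) where
  open Field F hiding (zero)
  open import Algebra.Properties.CommutativeSemigroup +-commutativeSemigroup using (x∙yz≈y∙xz)
  open import Algebra.Properties.CommutativeSemigroup *-commutativeSemigroup using ()
    renaming (interchange to *-interchange)
  open import Algebra.Properties.Group +-group using (//-rightDividesˡ; x≈y⇒x∙y⁻¹≈ε)
  open import Relation.Binary.Reasoning.Setoid setoid
  open ListSum +-commutativeMonoid
  open RingSums commutativeRing

  ι-1 : ι F 1 ≈ 1#
  ι-1 = +-identityʳ 1#

  ι-+ : ∀ m n → ι F (m ℕ.+ n) ≈ ι F m + ι F n
  ι-+ zero    n = sym (+-identityˡ _)
  ι-+ (suc m) n = trans (+-cong refl (ι-+ m n)) (sym (+-assoc _ _ _))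

  newtonSeries : ∀ d → (ℕ → Carrier) → ℕ → Carrier
  newtonSeries d μ x = ∑ (allFin (suc d)) (λ j → μ (toℕ j) * ι F (x C toℕ j))

  -- Newton's forward-difference expansion; x C 0 and 0 C suc j compute to 1 and 0.
  binomial-basis : ∀ d (f : ℕ → Carrier) → Σ[ μ ∈ (ℕ → Carrier) ] (∀ {x} → x ℕ.≤ d → newtonSeries d μ x ≈ f x)
  binomial-basis zero    f = f , λ { z≤n → trans (+-identityʳ _) (trans (*-cong refl ι-1) (*-identityʳ _)) }
  binomial-basis (suc d) f = μ , λ x≤ → trans (split _) (f0+tail x≤)
    where
      Δf : ℕ → Carrier
      Δf x = f (suc x) - f x
      ν : ℕ → Carrier
      ν = proj₁ (binomial-basis d Δf)
      μ : ℕ → Carrier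
      μ zero    = f 0
      μ (suc j) = ν j
      tail : ℕ → Carrier
      tail x = ∑ (allFin (suc d)) (λ j → ν (toℕ j) * ι F (x C suc (toℕ j)))
      split : ∀ x → newtonSeries (suc d) μ x ≈ f 0 + tail x
      split x = trans (reflexive (∑-allFin-suc (suc d) _)) (+-cong (trans (*-cong refl ι-1) (*-identityʳ _)) refl)
      tail-0 : tail 0 ≈ 0#
      tail-0 = ∑-vanishing (allFin (suc d)) (λ {j} _ → zeroʳ (ν (toℕ j)))
      tail-suc : ∀ x → tail (suc x) ≈ newtonSeries d ν x + tail x
      tail-suc x = trans (∑-cong (allFin (suc d)) pascal) (∑-distrib (allFin (suc d)) _ _)
        where
          pascal : ∀ j → ν (toℕ j) * ι F (suc x C suc (toℕ j))
                         ≈ ν (toℕ j) * ι F (x C toℕ j) + ν (toℕ j) * ι F (x C suc (toℕ j))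
          pascal j = trans (*-cong refl (trans (reflexive (≡.cong (ι F) (≡.sym (nCk+nC[k+1]≡[n+1]C[k+1] x (toℕ j)))))
                                               (ι-+ (x C toℕ j) (x C suc (toℕ j)))))
                           (distribˡ _ _ _)
      f0+tail : ∀ {x} → x ℕ.≤ suc d → f 0 + tail x ≈ f x
      f0+tail z≤n = trans (+-cong refl tail-0) (+-identityʳ _)
      f0+tail {suc x} (s≤s x≤d) = begin
        f 0 + tail (suc x)                     ≈⟨ +-cong refl (tail-suc x) ⟩
        f 0 + (newtonSeries d ν x + tail x)    ≈⟨ +-cong refl (+-cong (proj₂ (binomial-basis d Δf) x≤d) refl) ⟩
        f 0 + (Δf x + tail x)                  ≈⟨ x∙yz≈y∙xz _ _ _ ⟩
        Δf x + (f 0 + tail x)                  ≈⟨ +-cong refl (f0+tail (ℕ.m≤n⇒m≤1+n x≤d)) ⟩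
        Δf x + f x                             ≈⟨ //-rightDividesˡ _ _ ⟩
        f (suc x)                              ∎

  δ-toℕ : ∀ {m} (c c′ : Fin m) → δ (toℕ c) (toℕ c′) ≡ δ c c′
  δ-toℕ zero    zero     = ≡.refl
  δ-toℕ zero    (suc c′) = ≡.refl
  δ-toℕ (suc c) zero     = ≡.refl
  δ-toℕ (suc c) (suc c′) = δ-toℕ c c′

  binomialDual : ∀ d → Fin (suc d) → ℕ → Carrier
  binomialDual d c = proj₁ (binomial-basis d (δ (toℕ c)))

  newtonSeries-binomialDual : ∀ d (c′ c : Fin (suc d)) → newtonSeries d (binomialDual d c′) (toℕ c) ≈ δ c′ c
  newtonSeries-binomialDual d c′ c =
    trans (proj₂ (binomial-basis d (δ (toℕ c′))) (Fin.toℕ≤pred[n] c)) (reflexive (δ-toℕ c′ c))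

  newtonSeries-δ0 : ∀ d x → newtonSeries d (δ 0) x ≈ 1#
  newtonSeries-δ0 d x = begin
    newtonSeries d (δ 0) x                                                        ≡⟨ ∑-allFin-suc d _ ⟩
    δ 0 0 * ι F 1 + ∑ (allFin d) (λ j → δ 0 (suc (toℕ j)) * ι F (x C suc (toℕ j)))  ≈⟨ +-cong (*-cong (δ-refl 0) ι-1) higher ⟩
    1# * 1# + 0#                                                                  ≈⟨ trans (+-identityʳ _) (*-identityˡ 1#) ⟩
    1#                                                                            ∎
    where
      higher : ∑ (allFin d) (λ j → δ 0 (suc (toℕ j)) * ι F (x C suc (toℕ j))) ≈ 0#
      higher = ∑-vanishing (allFin d) (λ {j} _ → trans (*-cong (δ-≢ {x = 0} {suc (toℕ j)} (λ ())) refl) (zeroˡ _))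

  binomProd-undominated : ∀ {n d} (a b : Exp n d) → dominates a b ≡ false → binomProd F a b ≈ 0#
  binomProd-undominated []      []      ()
  binomProd-undominated (x ∷ a) (y ∷ b) ¬dom with toℕ y ℕ.≤ᵇ toℕ x
  ... | true  = trans (*-cong refl (binomProd-undominated a b ¬dom)) (zeroʳ _)
  ... | false = zeroˡ _  -- _C_ is defined by cases on this test, so toℕ x C toℕ y computes to 0

  binomSum : ∀ {n d} → (Exp n d → Carrier) → Exp n d → Carrier
  binomSum {n} {d} N y = ∑ (allExp n d) (λ x → N x * binomProd F y x)

  LowSupport : ∀ {n d} → ℕ → (Exp n d → Carrier) → Set ℓ
  LowSupport L N = ∀ x → L ℕ.≤ supp x → N x ≈ 0#

  Interpolant : ∀ {n d} → ℕ → List (Exp n d) → (Exp n d → Carrier) → Set (c ⊔ ℓ)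
  Interpolant {n} {d} L S g = Σ[ N ∈ (Exp n d → Carrier) ] (LowSupport L N × (∀ {y} → y ∈ S → binomSum N y ≈ g y))

  _⊗_ : ∀ {n d} → (ℕ → Carrier) → (Exp n d → Carrier) → Exp (suc n) d → Carrier
  (φ ⊗ N) (j ∷ x) = φ (toℕ j) * N x

  ∑-allExp-suc : ∀ n d (f : Exp (suc n) d → Carrier) →
                 ∑ (allExp (suc n) d) f ≈ ∑ (allFin (suc d)) (λ j → ∑ (allExp n d) (λ x → f (j ∷ x)))
  ∑-allExp-suc n d f = trans (∑-concatMap (λ i → map (i ∷_) (allExp n d)) (allFin (suc d)) f)
                             (∑-cong (allFin (suc d)) (λ j → reflexive (∑-map (j ∷_) (allExp n d) f)))

  binomSum-+ : ∀ {n d} (N N′ : Exp n d → Carrier) y → binomSum (λ x → N x + N′ x) y ≈ binomSum N y + binomSum N′ y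
  binomSum-+ {n} {d} N N′ y = trans (∑-cong (allExp n d) (λ x → distribʳ _ _ _)) (∑-distrib (allExp n d) _ _)

  binomSum-∑ : ∀ {n d} {X : Set} (K : List X) (N : X → Exp n d → Carrier) y →
               binomSum (λ x → ∑ K (λ c → N c x)) y ≈ ∑ K (λ c → binomSum (N c) y)
  binomSum-∑ {n} {d} K N y = trans (∑-cong (allExp n d) (λ x → ∑-*ʳ _ K _)) (∑-comm (allExp n d) K _)

  binomSum-⊗ : ∀ {n d} (φ : ℕ → Carrier) (N : Exp n d → Carrier) c y →
               binomSum (φ ⊗ N) (c ∷ y) ≈ newtonSeries d φ (toℕ c) * binomSum N y
  binomSum-⊗ {n} {d} φ N c y = begin
    binomSum (φ ⊗ N) (c ∷ y)                                                ≈⟨ ∑-allExp-suc n d _ ⟩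
    ∑ AF (λ j → ∑ M (λ x → (φ (toℕ j) * N x) * (κ j * binomProd F y x)))   ≈⟨ ∑-cong AF (λ j → ∑-cong M (λ x → *-interchange _ _ _ _)) ⟩
    ∑ AF (λ j → ∑ M (λ x → (φ (toℕ j) * κ j) * (N x * binomProd F y x)))   ≈⟨ ∑-cong AF (λ j → ∑-*ˡ _ M _) ⟨
    ∑ AF (λ j → (φ (toℕ j) * κ j) * binomSum N y)                          ≈⟨ ∑-*ʳ _ AF _ ⟨
    newtonSeries d φ (toℕ c) * binomSum N y                                 ∎
    where
      AF : List (Fin (suc d))
      AF = allFin (suc d)
      M : List (Exp n d)
      M = allExp n d
      κ : Fin (suc d) → Carrier
      κ j = ι F (toℕ c C toℕ j)

  low-+ : ∀ {n d L} {N N′ : Exp n d → Carrier} → LowSupport L N → LowSupport L N′ → LowSupport L (λ x → N x + N′ x)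
  low-+ lowN lowN′ x L≤ = trans (+-cong (lowN x L≤) (lowN′ x L≤)) (+-identityʳ 0#)

  low-∑ : ∀ {n d L} {X : Set} (K : List X) {N : X → Exp n d → Carrier} →
          (∀ c → LowSupport L (N c)) → LowSupport L (λ x → ∑ K (λ c → N c x))
  low-∑ K lowN x L≤ = ∑-vanishing K (λ {c} _ → lowN c x L≤)

  low-⊗ : ∀ {n d L} (φ : ℕ → Carrier) {N : Exp n d → Carrier} → LowSupport L N → LowSupport (suc L) (φ ⊗ N)
  low-⊗ φ lowN (zero  ∷ x) L<x       = trans (*-cong refl (lowN x (ℕ.≤-trans (ℕ.n≤1+n _) L<x))) (zeroʳ _)
  low-⊗ φ lowN (suc j ∷ x) (s≤s L≤x) = trans (*-cong refl (lowN x L≤x)) (zeroʳ _)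

  low-δ0⊗ : ∀ {n d L} {N : Exp n d → Carrier} → LowSupport (suc L) N → LowSupport (suc L) (δ 0 ⊗ N)
  low-δ0⊗ lowN (zero  ∷ x) L<x = trans (*-cong refl (lowN x L<x)) (zeroʳ _)
  low-δ0⊗ lowN (suc j ∷ x) _   = trans (*-cong (δ-≢ {x = 0} {suc (toℕ j)} (λ ())) refl) (zeroˡ _)

  glue : ∀ {n d} → (Exp n d → Carrier) → (Fin (suc d) → Exp n d → Carrier) → Exp (suc n) d → Carrier
  glue {d = d} G H v = (δ 0 ⊗ G) v + ∑ (allFin (suc d)) (λ c → (binomialDual d c ⊗ H c) v)

  glue-low : ∀ {n d L} {G : Exp n d → Carrier} {H : Fin (suc d) → Exp n d → Carrier} →
             LowSupport (suc L) G → (∀ c → LowSupport L (H c)) → LowSupport (suc L) (glue G H)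
  glue-low {d = d} lowG lowH = low-+ (low-δ0⊗ lowG) (low-∑ (allFin (suc d)) (λ c → low-⊗ (binomialDual d c) (lowH c)))

  binomSum-glue : ∀ {n d} (G : Exp n d → Carrier) (H : Fin (suc d) → Exp n d → Carrier) c y →
                  binomSum (glue G H) (c ∷ y) ≈ binomSum G y + binomSum (H c) y
  binomSum-glue {d = d} G H c y = begin
    binomSum (glue G H) (c ∷ y)
      ≈⟨ binomSum-+ (δ 0 ⊗ G) (λ v → ∑ AF (λ c′ → (binomialDual d c′ ⊗ H c′) v)) (c ∷ y) ⟩
    binomSum (δ 0 ⊗ G) (c ∷ y) + binomSum (λ v → ∑ AF (λ c′ → (binomialDual d c′ ⊗ H c′) v)) (c ∷ y)
      ≈⟨ +-cong (binomSum-⊗ _ G c y) (binomSum-∑ AF (λ c′ → binomialDual d c′ ⊗ H c′) (c ∷ y)) ⟩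
    newtonSeries d (δ 0) (toℕ c) * binomSum G y + ∑ AF (λ c′ → binomSum (binomialDual d c′ ⊗ H c′) (c ∷ y))
      ≈⟨ +-cong (*-cong (newtonSeries-δ0 d (toℕ c)) refl) (∑-cong AF (λ c′ → binomSum-⊗ _ (H c′) c y)) ⟩
    1# * binomSum G y + ∑ AF (λ c′ → newtonSeries d (binomialDual d c′) (toℕ c) * binomSum (H c′) y)
      ≈⟨ +-cong (*-identityˡ _) (∑-cong AF (λ c′ → trans (*-cong (newtonSeries-binomialDual d c′ c) refl) (*-comm _ _))) ⟩
    binomSum G y + ∑ AF (λ c′ → binomSum (H c′) y * δ c′ c)
      ≈⟨ +-cong refl (∑-δ (allFin⁺ _) (∈-allFin c) _) ⟩
    binomSum G y + binomSum (H c) y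
      ∎
    where
      AF : List (Fin (suc d))
      AF = allFin (suc d)

  zero-interpolant : ∀ {n d L} {S : List (Exp n d)} {g} → (∀ {y} → y ∈ S → g y ≈ 0#) → Interpolant L S g
  zero-interpolant {n} {d} g≈0 =
    (λ _ → 0#) , (λ _ _ → refl) , λ y∈S → trans (∑-vanishing (allExp n d) (λ _ → zeroˡ _)) (sym (g≈0 y∈S))

  interpolation : ∀ n {d} L (S : List (Exp n d)) g → length S ℕ.< 2 ℕ.^ L → Interpolant L S g
  interpolation n       L       []      g _        = zero-interpolant (λ ())
  interpolation n       zero    (_ ∷ _) g (s≤s ())
  interpolation zero    (suc L) (_ ∷ _) g _        =
    (λ _ → g []) , (λ { [] () }) , λ { {[]} _ → trans (+-identityʳ _) (*-identityʳ _) }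
  interpolation (suc n) {d} (suc L) S g |S|< =
    glue (proj₁ G) (proj₁ ∘ H) , glue-low (proj₁ (proj₂ G)) (proj₁ ∘ proj₂ ∘ H) , exact
    where
      -- Only the fibre over c* may be too large for support L; it is interpolated with support L + 1,
      -- the other fibres only have to correct the residual of G, which vanishes on the fibre over c*.
      c* : Fin (suc d)
      c* = proj₁ (at-most-one-large-fibre L S |S|<)
      small : ∀ c → c ≢ c* → length (fibre c S) ℕ.< 2 ℕ.^ L
      small = proj₂ (at-most-one-large-fibre L S |S|<)
      G : Interpolant (suc L) (fibre c* S) (λ y → g (c* ∷ y))
      G = interpolation n (suc L) (fibre c* S) _ (ℕ.≤-<-trans (fibre-length c* S) |S|<)
      residual : Fin (suc d) → Exp n d → Carrier
      residual c y = g (c ∷ y) - binomSum (proj₁ G) y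
      H : ∀ c → Interpolant L (fibre c S) (residual c)
      H c with c ≟ c*
      ... | yes ≡.refl = zero-interpolant (λ y∈ → x≈y⇒x∙y⁻¹≈ε (sym (proj₂ (proj₂ G) y∈)))
      ... | no c≢c*    = interpolation n L (fibre c S) (residual c) (small c c≢c*)
      exact : ∀ {y} → y ∈ S → binomSum (glue (proj₁ G) (proj₁ ∘ H)) y ≈ g y
      exact {c ∷ y} c∷y∈S = begin
        binomSum (glue (proj₁ G) (proj₁ ∘ H)) (c ∷ y)    ≈⟨ binomSum-glue _ _ c y ⟩
        binomSum (proj₁ G) y + binomSum (proj₁ (H c)) y  ≈⟨ +-cong refl (proj₂ (proj₂ (H c)) (∈-fibre S c∷y∈S)) ⟩
        binomSum (proj₁ G) y + residual c y              ≈⟨ +-comm _ _ ⟩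
        residual c y + binomSum (proj₁ G) y              ≈⟨ //-rightDividesˡ _ _ ⟩
        g (c ∷ y)                                        ∎

-- Polynomials in t and their action on A_k ⊗ F[t]

module Polynomials {c ℓ} (F : Field c ℓ) where
  open Field F hiding (zero)
  open ListSum +-commutativeMonoid

  Pol : Set c
  Pol = List Carrier

  infixl 6 _+ₚ_
  infixr 7 _·ₚ_
  infixl 7 _*ₚ_

  _+ₚ_ : Pol → Pol → Pol
  []      +ₚ q       = q
  (a ∷ p) +ₚ []      = a ∷ p
  (a ∷ p) +ₚ (b ∷ q) = a + b ∷ p +ₚ q

  _·ₚ_ : Carrier → Pol → Pol
  a ·ₚ p = map (a *_) p

  _*ₚ_ : Pol → Pol → Pol
  []      *ₚ q = []
  (a ∷ p) *ₚ q = a ·ₚ q +ₚ (0# ∷ p *ₚ q)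

  𝐭^_ : ℕ → Pol
  𝐭^ zero  = 1# ∷ []
  𝐭^ suc n = 0# ∷ 𝐭^ n

  ∑ₚ : {X : Set} → List X → (X → Pol) → Pol
  ∑ₚ []      f = []
  ∑ₚ (x ∷ L) f = f x +ₚ ∑ₚ L f

  ct : Pol → Carrier
  ct p = coeffT F p 0

  coeffT-+ₚ : ∀ p q i → coeffT F (p +ₚ q) i ≈ coeffT F p i + coeffT F q i
  coeffT-+ₚ []      q       i       = sym (+-identityˡ _)
  coeffT-+ₚ (a ∷ p) []      i       = sym (+-identityʳ _)
  coeffT-+ₚ (a ∷ p) (b ∷ q) zero    = refl
  coeffT-+ₚ (a ∷ p) (b ∷ q) (suc i) = coeffT-+ₚ p q i

  coeffT-·ₚ : ∀ a p i → coeffT F (a ·ₚ p) i ≈ a * coeffT F p i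
  coeffT-·ₚ a []      i       = sym (zeroʳ a)
  coeffT-·ₚ a (b ∷ p) zero    = refl
  coeffT-·ₚ a (b ∷ p) (suc i) = coeffT-·ₚ a p i

  ct-*ₚ : ∀ p q → ct (p *ₚ q) ≈ ct p * ct q
  ct-*ₚ []      q = sym (zeroˡ _)
  ct-*ₚ (a ∷ p) q = trans (coeffT-+ₚ (a ·ₚ q) (0# ∷ p *ₚ q) 0) (trans (+-identityʳ _) (coeffT-·ₚ a q 0))

  ct-∑ₚ : ∀ {X : Set} (L : List X) (f : X → Pol) → ct (∑ₚ L f) ≈ ∑ L (ct ∘ f)
  ct-∑ₚ []      f = refl
  ct-∑ₚ (x ∷ L) f = trans (coeffT-+ₚ (f x) (∑ₚ L f) 0) (+-cong refl (ct-∑ₚ L f))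

  ct-𝐭^-pos : ∀ {N} → 0 ℕ.< N → ct (𝐭^ N) ≈ 0#
  ct-𝐭^-pos {suc N} _ = refl

  coeffT-𝐭^*ₚ : ∀ N q → coeffT F (𝐭^ N *ₚ q) N ≈ ct q
  coeffT-𝐭^*ₚ zero    q =
    trans (coeffT-+ₚ (1# ·ₚ q) (0# ∷ []) 0) (trans (+-identityʳ _) (trans (coeffT-·ₚ 1# q 0) (*-identityˡ _)))
  coeffT-𝐭^*ₚ (suc N) q =
    trans (coeffT-+ₚ (0# ·ₚ q) (0# ∷ 𝐭^ N *ₚ q) (suc N))
          (trans (+-cong (trans (coeffT-·ₚ 0# q (suc N)) (zeroˡ _)) (coeffT-𝐭^*ₚ N q)) (+-identityˡ _))

module FtModule {c ℓ} (F : Field c ℓ) (k : ℕ) where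
  open Field F hiding (zero)
  open Polynomials F
  open ListSum +-commutativeMonoid
  open import Algebra.Properties.CommutativeSemigroup +-commutativeSemigroup using ()
    renaming (interchange to +-interchange)
  open import Algebra.Properties.CommutativeSemigroup *-commutativeSemigroup using (x∙yz≈y∙xz)
  open import Algebra.Properties.Ring ring using (-1*x≈-x)

  V : Set c
  V = TAlg F k

  Vᴳ : AbelianGroup c ℓ
  Vᴳ = Pointwise.abelianGroup ℕ (Pointwise.abelianGroup (Fin k) +-abelianGroup)

  open AbelianGroup Vᴳ public using (commutativeMonoid)
    renaming ( _≈_ to _≋_; _∙_ to infixl 6 _⊕_; ε to 𝟎; _⁻¹ to infix 8 ⊝_; ∙-cong to ⊕-cong; ⁻¹-cong to ⊝-cong
             ; refl to ≋-refl; sym to ≋-sym; trans to ≋-trans; reflexive to ≋-reflexive; setoid to ≋-setoid)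
  open ListSum commutativeMonoid public using ()
    renaming ( ∑ to ∑ᵥ; ∑-cong to ∑ᵥ-cong; ∑-ε to ∑ᵥ-𝟎; ∑-distrib to ∑ᵥ-distrib; ∑-comm to ∑ᵥ-comm
             ; ∑-filter to ∑ᵥ-filter; ∑-pick to ∑ᵥ-pick)
  open ListSumHom commutativeMonoid commutativeMonoid using () renaming (∑-hom to ∑ᵥ-hom)
  open import Algebra.Properties.AbelianGroup Vᴳ using (⁻¹-∙-comm)
  open import Algebra.Properties.Group (AbelianGroup.group Vᴳ) using (ε⁻¹≈ε)
  open import Relation.Binary.Reasoning.Setoid ≋-setoid

  infixr 7 _·ᵥ_ _▸_

  _·ᵥ_ : Carrier → V → V
  (a ·ᵥ v) m j = a * v m j

  t· : V → V
  t· v zero    j = 0#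
  t· v (suc m) j = v m j

  _▸_ : Pol → V → V
  p ▸ v = _•_ F p v

  ≋-split-at : ∀ N {u v : V} → (∀ m j → u (N ℕ.+ m) j ≈ v (N ℕ.+ m) j) →
               (∀ {m} j → m ℕ.< N → u m j ≈ v m j) → u ≋ v
  ≋-split-at N {u} {v} high low m j with N ℕ.≤? m
  ... | yes N≤m = ≡.subst (λ m → u m j ≈ v m j) (ℕ.m+[n∸m]≡n N≤m) (high (m ℕ.∸ N) j)
  ... | no  N≰m = low j (ℕ.≰⇒> N≰m)

  ·ᵥ-cong : ∀ {a u v} → u ≋ v → a ·ᵥ u ≋ a ·ᵥ v
  ·ᵥ-cong u≋v m j = *-cong refl (u≋v m j)

  *-·ᵥ : ∀ a b v → (a * b) ·ᵥ v ≋ a ·ᵥ b ·ᵥ v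
  *-·ᵥ a b v m j = *-assoc a b _

  -1·ᵥ : ∀ v → (- 1#) ·ᵥ v ≋ ⊝ v
  -1·ᵥ v m j = -1*x≈-x (v m j)

  t·-cong : ∀ {u v} → u ≋ v → t· u ≋ t· v
  t·-cong u≋v zero    j = refl
  t·-cong u≋v (suc m) j = u≋v m j

  ▸-cong : ∀ p {u v} → u ≋ v → p ▸ u ≋ p ▸ v
  ▸-cong []      u≋v m       j = refl
  ▸-cong (a ∷ p) u≋v zero    j = *-cong refl (u≋v 0 j)
  ▸-cong (a ∷ p) u≋v (suc m) j = +-cong (*-cong refl (u≋v (suc m) j)) (▸-cong p u≋v m j)

  ∷-▸ : ∀ a p v → (a ∷ p) ▸ v ≋ a ·ᵥ v ⊕ t· (p ▸ v)
  ∷-▸ a p v zero    j = sym (+-identityʳ _)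
  ∷-▸ a p v (suc m) j = refl

  0∷-▸ : ∀ p v → (0# ∷ p) ▸ v ≋ t· (p ▸ v)
  0∷-▸ p v zero    j = zeroˡ _
  0∷-▸ p v (suc m) j = trans (+-cong (zeroˡ _) refl) (+-identityˡ _)

  [a]-▸ : ∀ a v → (a ∷ []) ▸ v ≋ a ·ᵥ v
  [a]-▸ a v zero    j = refl
  [a]-▸ a v (suc m) j = +-identityʳ _

  ▸-𝟎 : ∀ p → p ▸ 𝟎 ≋ 𝟎
  ▸-𝟎 []      m       j = refl
  ▸-𝟎 (a ∷ p) zero    j = zeroʳ a
  ▸-𝟎 (a ∷ p) (suc m) j = trans (+-cong (zeroʳ a) (▸-𝟎 p m j)) (+-identityʳ 0#)

  ▸-⊕ : ∀ p u v → p ▸ (u ⊕ v) ≋ p ▸ u ⊕ p ▸ v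
  ▸-⊕ []      u v m       j = sym (+-identityʳ 0#)
  ▸-⊕ (a ∷ p) u v zero    j = distribˡ a _ _
  ▸-⊕ (a ∷ p) u v (suc m) j = trans (+-cong (distribˡ a _ _) (▸-⊕ p u v m j)) (+-interchange _ _ _ _)

  ▸-·ᵥ : ∀ p a v → p ▸ (a ·ᵥ v) ≋ a ·ᵥ (p ▸ v)
  ▸-·ᵥ []      a v m       j = sym (zeroʳ a)
  ▸-·ᵥ (b ∷ p) a v zero    j = x∙yz≈y∙xz b a _
  ▸-·ᵥ (b ∷ p) a v (suc m) j = trans (+-cong (x∙yz≈y∙xz b a _) (▸-·ᵥ p a v m j)) (sym (distribˡ a _ _))

  ▸-t· : ∀ p v → p ▸ t· v ≋ t· (p ▸ v)
  ▸-t· []      v zero          j = refl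
  ▸-t· []      v (suc m)       j = refl
  ▸-t· (a ∷ p) v zero          j = zeroʳ a
  ▸-t· (a ∷ p) v (suc zero)    j = trans (+-cong refl (▸-t· p v 0 j)) (+-identityʳ _)
  ▸-t· (a ∷ p) v (suc (suc m)) j = +-cong refl (▸-t· p v (suc m) j)

  ▸-comm : ∀ p q v → p ▸ q ▸ v ≋ q ▸ p ▸ v
  ▸-comm []      q v = ≋-sym (▸-𝟎 q)
  ▸-comm (a ∷ p) q v = begin
    (a ∷ p) ▸ q ▸ v                ≈⟨ ∷-▸ a p (q ▸ v) ⟩
    a ·ᵥ (q ▸ v) ⊕ t· (p ▸ q ▸ v)  ≈⟨ ⊕-cong (≋-sym (▸-·ᵥ q a v)) (t·-cong (▸-comm p q v)) ⟩
    q ▸ (a ·ᵥ v) ⊕ t· (q ▸ p ▸ v)  ≈⟨ ⊕-cong ≋-refl (▸-t· q (p ▸ v)) ⟨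
    q ▸ (a ·ᵥ v) ⊕ q ▸ t· (p ▸ v)  ≈⟨ ▸-⊕ q _ _ ⟨
    q ▸ (a ·ᵥ v ⊕ t· (p ▸ v))      ≈⟨ ▸-cong q (∷-▸ a p v) ⟨
    q ▸ (a ∷ p) ▸ v                ∎

  ▸-⊝ : ∀ p v → p ▸ ⊝ v ≋ ⊝ (p ▸ v)
  ▸-⊝ p v = begin
    p ▸ ⊝ v            ≈⟨ ▸-cong p (-1·ᵥ v) ⟨
    p ▸ ((- 1#) ·ᵥ v)  ≈⟨ ▸-·ᵥ p (- 1#) v ⟩
    (- 1#) ·ᵥ (p ▸ v)  ≈⟨ -1·ᵥ (p ▸ v) ⟩
    ⊝ (p ▸ v)          ∎

  +ₚ-▸ : ∀ p q v → (p +ₚ q) ▸ v ≋ p ▸ v ⊕ q ▸ v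
  +ₚ-▸ []      q       v m       j = sym (+-identityˡ _)
  +ₚ-▸ (a ∷ p) []      v m       j = sym (+-identityʳ _)
  +ₚ-▸ (a ∷ p) (b ∷ q) v zero    j = distribʳ _ a b
  +ₚ-▸ (a ∷ p) (b ∷ q) v (suc m) j = trans (+-cong (distribʳ _ a b) (+ₚ-▸ p q v m j)) (+-interchange _ _ _ _)

  ·ₚ-▸ : ∀ a p v → (a ·ₚ p) ▸ v ≋ a ·ᵥ (p ▸ v)
  ·ₚ-▸ a []      v m       j = sym (zeroʳ a)
  ·ₚ-▸ a (b ∷ p) v zero    j = *-assoc a b _
  ·ₚ-▸ a (b ∷ p) v (suc m) j = trans (+-cong (*-assoc a b _) (·ₚ-▸ a p v m j)) (sym (distribˡ a _ _))

  *ₚ-▸ : ∀ p q v → (p *ₚ q) ▸ v ≋ p ▸ q ▸ v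
  *ₚ-▸ []      q v = ≋-refl
  *ₚ-▸ (a ∷ p) q v = begin
    (a ·ₚ q +ₚ (0# ∷ p *ₚ q)) ▸ v     ≈⟨ +ₚ-▸ (a ·ₚ q) (0# ∷ p *ₚ q) v ⟩
    (a ·ₚ q) ▸ v ⊕ (0# ∷ p *ₚ q) ▸ v  ≈⟨ ⊕-cong (·ₚ-▸ a q v) (0∷-▸ (p *ₚ q) v) ⟩
    a ·ᵥ (q ▸ v) ⊕ t· ((p *ₚ q) ▸ v)  ≈⟨ ⊕-cong ≋-refl (t·-cong (*ₚ-▸ p q v)) ⟩
    a ·ᵥ (q ▸ v) ⊕ t· (p ▸ q ▸ v)     ≈⟨ ∷-▸ a p (q ▸ v) ⟨
    (a ∷ p) ▸ q ▸ v                   ∎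

  ∑ₚ-▸ : ∀ {X : Set} (L : List X) f v → ∑ₚ L f ▸ v ≋ ∑ᵥ L (λ x → f x ▸ v)
  ∑ₚ-▸ []      f v = ≋-refl
  ∑ₚ-▸ (x ∷ L) f v = ≋-trans (+ₚ-▸ (f x) (∑ₚ L f) v) (⊕-cong ≋-refl (∑ₚ-▸ L f v))

  𝐭^-▸-high : ∀ N v m j → (𝐭^ N ▸ v) (N ℕ.+ m) j ≈ v m j
  𝐭^-▸-high zero    v m j = trans ([a]-▸ 1# v m j) (*-identityˡ _)
  𝐭^-▸-high (suc N) v m j = trans (0∷-▸ (𝐭^ N) v (suc (N ℕ.+ m)) j) (𝐭^-▸-high N v m j)

  𝐭^-▸-low : ∀ N v {m} j → m ℕ.< N → (𝐭^ N ▸ v) m j ≈ 0#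
  𝐭^-▸-low (suc N) v {zero}  j _         = 0∷-▸ (𝐭^ N) v 0 j
  𝐭^-▸-low (suc N) v {suc m} j (s≤s m<N) = trans (0∷-▸ (𝐭^ N) v (suc m) j) (𝐭^-▸-low N v j m<N)

  ▸-∑ᵥ : ∀ p {X : Set} (L : List X) f → p ▸ ∑ᵥ L f ≋ ∑ᵥ L (λ x → p ▸ f x)
  ▸-∑ᵥ p = ∑ᵥ-hom (p ▸_) (▸-𝟎 p) (▸-⊕ p)

  ·ᵥ-∑ᵥ : ∀ a {X : Set} (L : List X) f → a ·ᵥ ∑ᵥ L f ≋ ∑ᵥ L (λ x → a ·ᵥ f x)
  ·ᵥ-∑ᵥ a = ∑ᵥ-hom (a ·ᵥ_) (λ m j → zeroʳ a) (λ u v m j → distribˡ a _ _)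

  ⊝-∑ᵥ : ∀ {X : Set} (L : List X) f → ⊝ ∑ᵥ L f ≋ ∑ᵥ L (λ x → ⊝ f x)
  ⊝-∑ᵥ = ∑ᵥ-hom ⊝_ ε⁻¹≈ε (λ u v → ≋-sym (⁻¹-∙-comm u v))

  ∑-·ᵥ : ∀ {X : Set} (L : List X) φ v → ∑ L φ ·ᵥ v ≋ ∑ᵥ L (λ x → φ x ·ᵥ v)
  ∑-·ᵥ L φ v = ∑-hom (_·ᵥ v) (λ m j → zeroˡ _) (λ a b m j → distribʳ _ a b) L φ
    where open ListSumHom +-commutativeMonoid commutativeMonoid using (∑-hom)

  ∑ᵥ-apply : ∀ {X : Set} (L : List X) f m j → ∑ᵥ L f m j ≈ ∑ L (λ x → f x m j)
  ∑ᵥ-apply L f m j = ∑-hom (λ v → v m j) refl (λ _ _ → refl) L f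
    where open ListSumHom commutativeMonoid +-commutativeMonoid using (∑-hom)

  sumT≋∑ᵥ : ∀ {X : Set} (L : List X) f → sumT F L f ≋ ∑ᵥ L f
  sumT≋∑ᵥ []      f m j = refl
  sumT≋∑ᵥ (x ∷ L) f m j = +-cong refl (sumT≋∑ᵥ L f m j)

-- F[t]-spans and elimination

module FtSpan {c ℓ} (F : Field c ℓ) (k : ℕ) where
  open Field F hiding (zero)
  open Polynomials F
  open FtModule F k
  open ListSum +-commutativeMonoid
  open RingSums commutativeRing using (δ; δ-refl; δ-≢; ∑-δ)
  open import Algebra.Properties.AbelianGroup Vᴳ using (⁻¹-∙-comm)
  open import Algebra.Properties.Group (AbelianGroup.group Vᴳ) using (//-rightDividesʳ)
  open import Algebra.Properties.CommutativeSemigroup (AbelianGroup.commutativeSemigroup Vᴳ) using ()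
    renaming (interchange to ⊕-interchange)
  open AbelianGroup Vᴳ using () renaming (inverseʳ to ⊕-inverseʳ; identityˡ to ⊕-identityˡ)
  module ≈-Reasoning = Relation.Binary.Reasoning.Setoid setoid
  module ≋-Reasoning = Relation.Binary.Reasoning.Setoid ≋-setoid

  record Span {X : Set} (B : List X) (f : X → V) (v : V) : Set (c ⊔ ℓ) where
    constructor _,_
    field
      coefficient : X → Pol
      expansion   : v ≋ ∑ᵥ B (λ b → coefficient b ▸ f b)

  module _ {X : Set} {B : List X} {f : X → V} where
    open ≋-Reasoning

    span-cong : ∀ {u v} → u ≋ v → Span B f u → Span B f v
    span-cong u≋v (Λ , u≋) = Λ , ≋-trans (≋-sym u≋v) u≋

    span-𝟎 : Span B f 𝟎
    span-𝟎 = (λ _ → []) , ≋-sym (∑ᵥ-𝟎 B)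

    span-⊕ : ∀ {u v} → Span B f u → Span B f v → Span B f (u ⊕ v)
    span-⊕ {u} {v} (Λ , u≋) (Λ′ , v≋) = (λ b → Λ b +ₚ Λ′ b) , (begin
      u ⊕ v                                             ≈⟨ ⊕-cong u≋ v≋ ⟩
      ∑ᵥ B (λ b → Λ b ▸ f b) ⊕ ∑ᵥ B (λ b → Λ′ b ▸ f b)  ≈⟨ ∑ᵥ-distrib B _ _ ⟨
      ∑ᵥ B (λ b → Λ b ▸ f b ⊕ Λ′ b ▸ f b)               ≈⟨ ∑ᵥ-cong B (λ b → +ₚ-▸ (Λ b) (Λ′ b) (f b)) ⟨
      ∑ᵥ B (λ b → (Λ b +ₚ Λ′ b) ▸ f b)                  ∎)

    span-▸ : ∀ p {v} → Span B f v → Span B f (p ▸ v)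
    span-▸ p {v} (Λ , v≋) = (λ b → p *ₚ Λ b) , (begin
      p ▸ v                          ≈⟨ ▸-cong p v≋ ⟩
      p ▸ ∑ᵥ B (λ b → Λ b ▸ f b)     ≈⟨ ▸-∑ᵥ p B _ ⟩
      ∑ᵥ B (λ b → p ▸ Λ b ▸ f b)     ≈⟨ ∑ᵥ-cong B (λ b → *ₚ-▸ p (Λ b) (f b)) ⟨
      ∑ᵥ B (λ b → (p *ₚ Λ b) ▸ f b)  ∎)

    span-·ᵥ : ∀ a {v} → Span B f v → Span B f (a ·ᵥ v)
    span-·ᵥ a = span-cong ([a]-▸ a _) ∘ span-▸ (a ∷ [])

    span-⊝ : ∀ {v} → Span B f v → Span B f (⊝ v)
    span-⊝ = span-cong (-1·ᵥ _) ∘ span-·ᵥ (- 1#)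

    span-∑ : ∀ {Y : Set} (K : List Y) {v : Y → V} → (∀ {l} → l ∈ K → Span B f (v l)) → Span B f (∑ᵥ K v)
    span-∑ []      _  = span-𝟎
    span-∑ (l ∷ K) sp = span-⊕ (sp (here ≡.refl)) (span-∑ K (sp ∘ there))

    span-trans : ∀ {Y : Set} {K : List Y} {g : Y → V} {v} → Span K g v → (∀ {l} → l ∈ K → Span B f (g l)) → Span B f v
    span-trans {K = K} (Λ , v≋) sp = span-cong (≋-sym v≋) (span-∑ K (λ l∈K → span-▸ (Λ _) (sp l∈K)))

    span-▸-generators : ∀ p {v} → Span B f v → Span B (λ b → p ▸ f b) (p ▸ v)
    span-▸-generators p {v} (Λ , v≋) = Λ , (begin
      p ▸ v                       ≈⟨ ▸-cong p v≋ ⟩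
      p ▸ ∑ᵥ B (λ b → Λ b ▸ f b)  ≈⟨ ▸-∑ᵥ p B _ ⟩
      ∑ᵥ B (λ b → p ▸ Λ b ▸ f b)  ≈⟨ ∑ᵥ-cong B (λ b → ▸-comm p (Λ b) (f b)) ⟩
      ∑ᵥ B (λ b → Λ b ▸ p ▸ f b)  ∎)

    span⇒InFtSpan : ∀ q {v} → (∃[ i ] ¬ (coeffT F q i ≈ 0#)) → Span B f (q ▸ v) → InFtSpan F v B f
    span⇒InFtSpan q nonzero (Λ , qv≋) = q , nonzero , Λ , λ m j → trans (qv≋ m j) (sym (sumT≋∑ᵥ B _ m j))

  cancel-common : ∀ x y z → (x ⊕ y) ⊕ ⊝ (x ⊕ z) ≋ y ⊕ ⊝ z
  cancel-common x y z = begin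
    (x ⊕ y) ⊕ ⊝ (x ⊕ z)    ≈⟨ ⊕-cong ≋-refl (⁻¹-∙-comm x z) ⟨
    (x ⊕ y) ⊕ (⊝ x ⊕ ⊝ z)  ≈⟨ ⊕-interchange x y (⊝ x) (⊝ z) ⟩
    (x ⊕ ⊝ x) ⊕ (y ⊕ ⊝ z)  ≈⟨ ⊕-cong (⊕-inverseʳ x) ≋-refl ⟩
    𝟎 ⊕ (y ⊕ ⊝ z)          ≈⟨ ⊕-identityˡ _ ⟩
    y ⊕ ⊝ z                ∎
    where open ≋-Reasoning

  cross-cancel : ∀ a b w r r′ → a ▸ (b ▸ w ⊕ r) ⊕ ⊝ (b ▸ (a ▸ w ⊕ r′)) ≋ a ▸ r ⊕ ⊝ (b ▸ r′)
  cross-cancel a b w r r′ = begin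
    a ▸ (b ▸ w ⊕ r) ⊕ ⊝ (b ▸ (a ▸ w ⊕ r′))        ≈⟨ ⊕-cong (▸-⊕ a _ r) (⊝-cong (▸-⊕ b _ r′)) ⟩
    (a ▸ b ▸ w ⊕ a ▸ r) ⊕ ⊝ (b ▸ a ▸ w ⊕ b ▸ r′)  ≈⟨ ⊕-cong ≋-refl (⊝-cong (⊕-cong (▸-comm b a w) ≋-refl)) ⟩
    (a ▸ b ▸ w ⊕ a ▸ r) ⊕ ⊝ (a ▸ b ▸ w ⊕ b ▸ r′)  ≈⟨ cancel-common _ _ _ ⟩
    a ▸ r ⊕ ⊝ (b ▸ r′)                            ∎
    where open ≋-Reasoning

  module _ {X : Set} {{_ : IsDecEquivalence {A = X} _≡_}} where

    δ·ᵥ : ∀ (x y : X) v → δ x y ·ᵥ v ≋ (if does (x ≟ y) then v else 𝟎)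
    δ·ᵥ x y v m j with does (x ≟ y)
    ... | true  = *-identityˡ _
    ... | false = zeroˡ _

    ∑ᵥ-δ : ∀ {L : List X} → Unique L → ∀ {s} → s ∈ L → (v : X → V) → ∑ᵥ L (λ x → δ x s ·ᵥ v x) ≋ v s
    ∑ᵥ-δ {L} uL {s} s∈L v = ≋-trans (∑ᵥ-cong L (λ x → δ·ᵥ x s (v x))) (∑ᵥ-pick uL s∈L v)

    span-∈ : ∀ {B : List X} {f : X → V} → Unique B → ∀ {b} → b ∈ B → Span B f (f b)
    span-∈ {B} {f} uB {b} b∈B =
      (λ b′ → δ b′ b ∷ []) , ≋-sym (≋-trans (∑ᵥ-cong B (λ b′ → [a]-▸ (δ b′ b) (f b′))) (∑ᵥ-δ uB b∈B f))

    IdentityModT : List X → (X → V) → (X → V) → Set (c ⊔ ℓ)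
    IdentityModT S u e = Σ[ M ∈ (X → X → Pol) ]
      ((∀ i → u i ≋ ∑ᵥ S (λ j → M i j ▸ e j)) × (∀ i {j} → j ∈ S → ct (M i j) ≈ δ i j))

    module Pivot {x : X} {S : List X} {u e : X → V} (x∉S : All (x ≢_) S) (M : X → X → Pol)
                 (u≋ : ∀ i → u i ≋ ∑ᵥ (x ∷ S) (λ j → M i j ▸ e j))
                 (ct-M : ∀ i {j} → j ∈ x ∷ S → ct (M i j) ≈ δ i j) where

      a : Pol
      a = M x x

      ct-a : ct a ≈ 1#
      ct-a = trans (ct-M x (here ≡.refl)) (δ-refl x)

      rest : X → V
      rest i = ∑ᵥ S (λ j → M i j ▸ e j)

      u′ : X → V
      u′ i = a ▸ u i ⊕ ⊝ (M i x ▸ u x)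

      M′ : X → X → Pol
      M′ i j = a *ₚ M i j +ₚ (- 1#) ·ₚ (M i x *ₚ M x j)

      M′-▸ : ∀ i j → M′ i j ▸ e j ≋ a ▸ M i j ▸ e j ⊕ ⊝ (M i x ▸ M x j ▸ e j)
      M′-▸ i j = ≋-trans (+ₚ-▸ (a *ₚ M i j) ((- 1#) ·ₚ (M i x *ₚ M x j)) (e j))
        (⊕-cong (*ₚ-▸ a (M i j) (e j))
                (≋-trans (·ₚ-▸ (- 1#) (M i x *ₚ M x j) (e j)) (≋-trans (-1·ᵥ _) (⊝-cong (*ₚ-▸ (M i x) (M x j) (e j))))))

      u′≋ : ∀ i → u′ i ≋ ∑ᵥ S (λ j → M′ i j ▸ e j)
      u′≋ i = begin
        a ▸ u i ⊕ ⊝ (M i x ▸ u x)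
          ≈⟨ ⊕-cong (▸-cong a (u≋ i)) (⊝-cong (▸-cong (M i x) (u≋ x))) ⟩
        a ▸ (M i x ▸ e x ⊕ rest i) ⊕ ⊝ (M i x ▸ (a ▸ e x ⊕ rest x))
          ≈⟨ cross-cancel a (M i x) (e x) (rest i) (rest x) ⟩
        a ▸ rest i ⊕ ⊝ (M i x ▸ rest x)
          ≈⟨ ⊕-cong (▸-∑ᵥ a S _) (≋-trans (⊝-cong (▸-∑ᵥ (M i x) S _)) (⊝-∑ᵥ S _)) ⟩
        ∑ᵥ S (λ j → a ▸ M i j ▸ e j) ⊕ ∑ᵥ S (λ j → ⊝ (M i x ▸ M x j ▸ e j))
          ≈⟨ ∑ᵥ-distrib S _ _ ⟨
        ∑ᵥ S (λ j → a ▸ M i j ▸ e j ⊕ ⊝ (M i x ▸ M x j ▸ e j))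
          ≈⟨ ∑ᵥ-cong S (λ j → ≋-sym (M′-▸ i j)) ⟩
        ∑ᵥ S (λ j → M′ i j ▸ e j)
          ∎
        where open ≋-Reasoning

      ct-M′ : ∀ i {j} → j ∈ S → ct (M′ i j) ≈ δ i j
      ct-M′ i {j} j∈S = begin
        ct (M′ i j)
          ≈⟨ coeffT-+ₚ (a *ₚ M i j) ((- 1#) ·ₚ (M i x *ₚ M x j)) 0 ⟩
        ct (a *ₚ M i j) + ct ((- 1#) ·ₚ (M i x *ₚ M x j))
          ≈⟨ +-cong (ct-*ₚ a (M i j)) (trans (coeffT-·ₚ (- 1#) (M i x *ₚ M x j) 0) (*-cong refl (ct-*ₚ (M i x) (M x j)))) ⟩
        ct a * ct (M i j) + (- 1#) * (ct (M i x) * ct (M x j))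
          ≈⟨ +-cong (*-cong ct-a (ct-M i (there j∈S))) (*-cong refl (*-cong refl (ct-M x (there j∈S)))) ⟩
        1# * δ i j + (- 1#) * (ct (M i x) * δ x j)
          ≈⟨ +-cong (*-identityˡ _) (*-cong refl (trans (*-cong refl (δ-≢ (λ x≡j → All.lookup x∉S j∈S x≡j))) (zeroʳ _))) ⟩
        δ i j + (- 1#) * 0#
          ≈⟨ trans (+-cong refl (zeroʳ _)) (+-identityʳ _) ⟩
        δ i j
          ∎
        where open ≈-Reasoning

      reduced : IdentityModT S u′ e
      reduced = M′ , u′≋ , ct-M′

      u′-span : Unique (x ∷ S) → ∀ {i} → i ∈ S → Span (x ∷ S) u (u′ i)
      u′-span uxS {i} i∈S =
        span-⊕ (span-▸ a (span-∈ uxS (there i∈S))) (span-⊝ (span-▸ (M i x) (span-∈ uxS (here ≡.refl))))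

      pivot-row : ∀ p → p ▸ a ▸ e x ≋ p ▸ u x ⊕ ⊝ ∑ᵥ S (λ j → M x j ▸ p ▸ e j)
      pivot-row p = begin
        p ▸ a ▸ e x                              ≈⟨ ▸-cong p (//-rightDividesʳ (rest x) (a ▸ e x)) ⟨
        p ▸ ((a ▸ e x ⊕ rest x) ⊕ ⊝ rest x)      ≈⟨ ▸-cong p (⊕-cong (≋-sym (u≋ x)) ≋-refl) ⟩
        p ▸ (u x ⊕ ⊝ rest x)                     ≈⟨ ≋-trans (▸-⊕ p _ _) (⊕-cong ≋-refl (▸-⊝ p _)) ⟩
        p ▸ u x ⊕ ⊝ (p ▸ rest x)                 ≈⟨ ⊕-cong ≋-refl (⊝-cong (▸-∑ᵥ p S _)) ⟩
        p ▸ u x ⊕ ⊝ ∑ᵥ S (λ j → p ▸ M x j ▸ e j)  ≈⟨ ⊕-cong ≋-refl (⊝-cong (∑ᵥ-cong S (λ j → ▸-comm p (M x j) (e j)))) ⟩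
        p ▸ u x ⊕ ⊝ ∑ᵥ S (λ j → M x j ▸ p ▸ e j)  ∎
        where open ≋-Reasoning

    record Elimination (S : List X) (u e : X → V) : Set (c ⊔ ℓ) where
      constructor eliminated
      field
        multiplier    : Pol
        ct-multiplier : ct multiplier ≈ 1#
        span-multiple : ∀ {j} → j ∈ S → Span S u (multiplier ▸ e j)

    gaussian-elimination : ∀ {S : List X} {u e : X → V} → Unique S → IdentityModT S u e → Elimination S u e
    gaussian-elimination {[]}    _ _ = eliminated (1# ∷ []) refl λ ()
    gaussian-elimination {x ∷ S} {u} {e} uxS@(x∉S ∷ uS) (M , u≋ , ct-M) =
      eliminated (a *ₚ q′) ct-q λ { (here ≡.refl) → span-pivot ; (there j∈S) → span-rest j∈S }
      where
        open Pivot x∉S M u≋ ct-M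
        open Elimination (gaussian-elimination uS reduced)
          renaming (multiplier to q′; ct-multiplier to ct-q′; span-multiple to span-q′e′)

        span-q′e : ∀ {j} → j ∈ S → Span (x ∷ S) u (q′ ▸ e j)
        span-q′e j∈S = span-trans (span-q′e′ j∈S) (u′-span uxS)

        ct-q : ct (a *ₚ q′) ≈ 1#
        ct-q = trans (ct-*ₚ a q′) (trans (*-cong ct-a ct-q′) (*-identityˡ 1#))

        span-rest : ∀ {j} → j ∈ S → Span (x ∷ S) u ((a *ₚ q′) ▸ e j)
        span-rest j∈S = span-cong (≋-sym (*ₚ-▸ a q′ _)) (span-▸ a (span-q′e j∈S))

        span-pivot : Span (x ∷ S) u ((a *ₚ q′) ▸ e x)
        span-pivot = span-cong (≋-sym (≋-trans (*ₚ-▸ a q′ (e x)) (≋-trans (▸-comm a q′ (e x)) (pivot-row q′))))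
          (span-⊕ (span-▸ q′ (span-∈ uxS (here ≡.refl)))
                  (span-⊝ (span-∑ S (λ {j} j∈S → span-▸ (M x j) (span-q′e j∈S)))))

    combine-rows : ∀ {L S : List X} {u e : X → V} → Unique L → (∀ {s} → s ∈ S → s ∈ L) → IdentityModT S u e →
                   (Φ : X → X → Carrier) → (∀ i {j} → j ∈ S → Φ i j ≈ δ i j) →
                   IdentityModT S (λ i → ∑ᵥ L (λ c → Φ i c ·ᵥ u c)) e
    combine-rows {L} {S} {u} {e} uL S⊆L (M , u≋ , ct-M) Φ Φ≈δ = M′ , expand , ct-M′
      where
        M′ : X → X → Pol
        M′ i j = ∑ₚ L (λ c → Φ i c ·ₚ M c j)

        expand : ∀ i → ∑ᵥ L (λ c → Φ i c ·ᵥ u c) ≋ ∑ᵥ S (λ j → M′ i j ▸ e j)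
        expand i = begin
          ∑ᵥ L (λ c → Φ i c ·ᵥ u c)                          ≈⟨ ∑ᵥ-cong L (λ c → ·ᵥ-cong (u≋ c)) ⟩
          ∑ᵥ L (λ c → Φ i c ·ᵥ ∑ᵥ S (λ j → M c j ▸ e j))     ≈⟨ ∑ᵥ-cong L (λ c → ·ᵥ-∑ᵥ (Φ i c) S _) ⟩
          ∑ᵥ L (λ c → ∑ᵥ S (λ j → Φ i c ·ᵥ M c j ▸ e j))     ≈⟨ ∑ᵥ-comm L S _ ⟩
          ∑ᵥ S (λ j → ∑ᵥ L (λ c → Φ i c ·ᵥ M c j ▸ e j))     ≈⟨ ∑ᵥ-cong S (λ j → ∑ᵥ-cong L (λ c → ·ₚ-▸ (Φ i c) (M c j) (e j))) ⟨
          ∑ᵥ S (λ j → ∑ᵥ L (λ c → (Φ i c ·ₚ M c j) ▸ e j))   ≈⟨ ∑ᵥ-cong S (λ j → ∑ₚ-▸ L _ (e j)) ⟨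
          ∑ᵥ S (λ j → M′ i j ▸ e j)                          ∎
          where open ≋-Reasoning

        ct-M′ : ∀ i {j} → j ∈ S → ct (M′ i j) ≈ δ i j
        ct-M′ i {j} j∈S = begin
          ct (M′ i j)                         ≈⟨ ct-∑ₚ L _ ⟩
          ∑ L (λ c → ct (Φ i c ·ₚ M c j))     ≈⟨ ∑-cong L (λ c → trans (coeffT-·ₚ (Φ i c) (M c j) 0) (*-cong refl (ct-M c j∈S))) ⟩
          ∑ L (λ c → Φ i c * δ c j)           ≈⟨ ∑-δ uL (S⊆L j∈S) (Φ i) ⟩
          Φ i j                               ≈⟨ Φ≈δ i j∈S ⟩
          δ i j                               ∎
          where open ≈-Reasoning

-- Concentration of A(x + t^w)

module Concentration {c ℓ} (F : Field c ℓ) {k n d : ℕ} (A : Poly F k n d) (w : Fin n → ℕ) where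
  open Field F hiding (zero)
  open Polynomials F
  open FtModule F k
  open FtSpan F k
  open ListSum +-commutativeMonoid
  open RingSums commutativeRing using (δ; δ-≢; δ-sym)
  open Interpolation F using (binomSum; LowSupport; Interpolant; interpolation; binomProd-undominated)
  open import Data.List.Membership.DecPropositional {A = Exp n d} _≟_ using (_∈?_)

  M : List (Exp n d)
  M = allExp n d

  infixl 8 _·t^_
  _·t^_ : Alg F k → ℕ → V
  (α ·t^ N) m j = if N ℕ.≡ᵇ m then α j else 0#

  E : Exp n d → V
  E a = A a ·t^ wt w a

  A′ : Exp n d → V
  A′ = shift F A w

  ·t^-vanishes : ∀ α {N m} j → N ≢ m → (α ·t^ N) m j ≈ 0#
  ·t^-vanishes α {N} {m} j N≢m =
    reflexive (≡.cong (λ b → if b then α j else 0#) (dec-false (N ℕ.≟ m) N≢m))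

  ·t^-cong : ∀ {α β : Alg F k} N → (∀ j → α j ≈ β j) → α ·t^ N ≋ β ·t^ N
  ·t^-cong N α≈β m j with N ℕ.≡ᵇ m
  ... | true  = α≈β j
  ... | false = refl

  𝐭^-▸-·t^ : ∀ N α K → 𝐭^ N ▸ α ·t^ K ≋ α ·t^ (N ℕ.+ K)
  𝐭^-▸-·t^ N α K = ≋-split-at N
    (λ m j → trans (𝐭^-▸-high N _ m j) (reflexive (≡.cong (λ b → if b then α j else 0#) (≡.sym (≡ᵇ-+ N K m)))))
    (λ j m<N → trans (𝐭^-▸-low N _ j m<N)
                     (sym (·t^-vanishes α j (≡.≢-sym (ℕ.<⇒≢ (ℕ.<-≤-trans m<N (ℕ.m≤m+n N K)))))))

  sumF-map : ∀ {X : Set} (L : List X) f → sumF F (map f L) ≡ ∑ L f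
  sumF-map []      f = ≡.refl
  sumF-map (x ∷ L) f = ≡.cong (f x +_) (sumF-map L f)

  sumAlg-apply : ∀ {X : Set} (L : List X) (f : X → Alg F k) j → sumAlg F L f j ≡ ∑ L (λ x → f x j)
  sumAlg-apply []      f j = ≡.refl
  sumAlg-apply (x ∷ L) f j = ≡.cong (f x j +_) (sumAlg-apply L f j)

  sumAlg-·t^ : ∀ {X : Set} (L : List X) (φ : X → Carrier) (α : X → Alg F k) N →
               sumAlg F L (λ b i → φ b * α b i) ·t^ N ≋ ∑ᵥ L (λ b → φ b ·ᵥ α b ·t^ N)
  sumAlg-·t^ L φ α N m j = trans (pointwise (N ℕ.≡ᵇ m)) (sym (∑ᵥ-apply L _ m j))
    where
      pointwise : ∀ b → (if b then sumAlg F L (λ b i → φ b * α b i) j else 0#)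
                        ≈ ∑ L (λ x → φ x * (if b then α x j else 0#))
      pointwise true  = reflexive (sumAlg-apply L _ j)
      pointwise false = sym (∑-vanishing L (λ _ → zeroʳ _))

  shift-identity : ∀ b → 𝐭^ (wt w b) ▸ A′ b ≋ ∑ᵥ M (λ a → binomProd F a b ·ᵥ E a)
  shift-identity b = ≋-split-at (wt w b) high low
    where
      term : ∀ a m j → (if dominates a b ∧ (wt w a ℕ.≡ᵇ wt w b ℕ.+ m) then binomProd F a b * A a j else 0#)
                       ≈ binomProd F a b * E a (wt w b ℕ.+ m) j
      term a m j with dominates a b in dom | wt w a ℕ.≡ᵇ wt w b ℕ.+ m
      ... | true  | true  = refl
      ... | true  | false = sym (zeroʳ _)
      ... | false | _     = sym (trans (*-cong (binomProd-undominated a b dom) refl) (zeroˡ _))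
      high : ∀ m j → (𝐭^ (wt w b) ▸ A′ b) (wt w b ℕ.+ m) j ≈ ∑ᵥ M (λ a → binomProd F a b ·ᵥ E a) (wt w b ℕ.+ m) j
      high m j = begin
        (𝐭^ (wt w b) ▸ A′ b) (wt w b ℕ.+ m) j                ≈⟨ 𝐭^-▸-high (wt w b) (A′ b) m j ⟩
        A′ b m j                                             ≡⟨ sumF-map M _ ⟩
        ∑ M (λ a → if dominates a b ∧ (wt w a ℕ.≡ᵇ wt w b ℕ.+ m) then binomProd F a b * A a j else 0#)
                                                             ≈⟨ ∑-cong M (λ a → term a m j) ⟩
        ∑ M (λ a → binomProd F a b * E a (wt w b ℕ.+ m) j)    ≈⟨ ∑ᵥ-apply M _ _ j ⟨
        ∑ᵥ M (λ a → binomProd F a b ·ᵥ E a) (wt w b ℕ.+ m) j  ∎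
        where open Relation.Binary.Reasoning.Setoid setoid
      vanish : ∀ {m} j a → m ℕ.< wt w b → binomProd F a b * E a m j ≈ 0#
      vanish j a m<wb with dominates a b in dom
      ... | true  = trans (*-cong refl (·t^-vanishes (A a) j
                      (≡.≢-sym (ℕ.<⇒≢ (ℕ.<-≤-trans m<wb (dominates⇒wt≤ w a b dom)))))) (zeroʳ _)
      ... | false = trans (*-cong (binomProd-undominated a b dom) refl) (zeroˡ _)
      low : ∀ {m} j → m ℕ.< wt w b → (𝐭^ (wt w b) ▸ A′ b) m j ≈ ∑ᵥ M (λ a → binomProd F a b ·ᵥ E a) m j
      low {m} j m<wb = trans (𝐭^-▸-low (wt w b) (A′ b) j m<wb)
                             (sym (trans (∑ᵥ-apply M _ m j) (∑-vanishing M (λ {a} _ → vanish j a m<wb))))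

  lowSupport : ℕ → List (Exp n d)
  lowSupport L = filter (λ y → supp y ℕ.<? L) M

  span-binomSum : ∀ {L} N → LowSupport L N → Span (lowSupport L) A′ (∑ᵥ M (λ c → binomSum N c ·ᵥ E c))
  span-binomSum {L} N low = (λ y → N y ·ₚ 𝐭^ (wt w y)) , (begin
    ∑ᵥ M (λ c → binomSum N c ·ᵥ E c)
      ≈⟨ ∑ᵥ-cong M (λ c → ∑-·ᵥ M _ (E c)) ⟩
    ∑ᵥ M (λ c → ∑ᵥ M (λ y → (N y * binomProd F c y) ·ᵥ E c))
      ≈⟨ ∑ᵥ-comm M M _ ⟩
    ∑ᵥ M (λ y → ∑ᵥ M (λ c → (N y * binomProd F c y) ·ᵥ E c))
      ≈⟨ ∑ᵥ-cong M (λ y → ≋-trans (∑ᵥ-cong M (λ c → *-·ᵥ _ _ (E c))) (≋-sym (·ᵥ-∑ᵥ (N y) M _))) ⟩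
    ∑ᵥ M (λ y → N y ·ᵥ ∑ᵥ M (λ c → binomProd F c y ·ᵥ E c))
      ≈⟨ ∑ᵥ-cong M (λ y → ·ᵥ-cong (shift-identity y)) ⟨
    ∑ᵥ M (λ y → N y ·ᵥ 𝐭^ (wt w y) ▸ A′ y)
      ≈⟨ ∑ᵥ-cong M (λ y → keep-low y (supp y ℕ.<? L)) ⟩
    ∑ᵥ M (λ y → if does (supp y ℕ.<? L) then (N y ·ₚ 𝐭^ (wt w y)) ▸ A′ y else 𝟎)
      ≈⟨ ∑ᵥ-filter (λ y → supp y ℕ.<? L) M _ ⟨
    ∑ᵥ (lowSupport L) (λ y → (N y ·ₚ 𝐭^ (wt w y)) ▸ A′ y)
      ∎)
    where
      open Relation.Binary.Reasoning.Setoid ≋-setoid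
      keep-low : ∀ y D → N y ·ᵥ 𝐭^ (wt w y) ▸ A′ y ≋ (if does D then (N y ·ₚ 𝐭^ (wt w y)) ▸ A′ y else 𝟎)
      keep-low y (yes _)     = ≋-sym (·ₚ-▸ (N y) (𝐭^ (wt w y)) (A′ y))
      keep-low y (no ¬<) m j = trans (*-cong (low y (ℕ.≮⇒≥ ¬<)) refl) (zeroˡ _)

  module _ (BI : IsBasisIsolating F A w) where
    private
      S : List (Exp n d)
      S = proj₁ BI
      uS : Unique S
      uS = proj₁ (proj₂ BI)
      isolate : ∀ a → a ∉ S → Σ[ λs ∈ (Exp n d → Carrier) ]
                  (∀ j → A a j ≈ sumAlg F (filter (λ b → wt w b ℕ.<? wt w a) S) (λ b i → λs b * A b i) j)
      isolate = proj₂ (proj₂ (proj₂ (proj₂ BI)))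

    isolatedRow : ∀ {a} → a ∉ S → ∀ s → Dec (wt w s ℕ.< wt w a) → Pol
    isolatedRow {a} a∉S s (yes _) = proj₁ (isolate a a∉S) s ·ₚ 𝐭^ (wt w a ℕ.∸ wt w s)
    isolatedRow     a∉S s (no _)  = []

    isolatedRow-▸ : ∀ {a} (a∉S : a ∉ S) s D →
                    isolatedRow a∉S s D ▸ E s ≋ (if does D then proj₁ (isolate a a∉S) s ·ᵥ A s ·t^ wt w a else 𝟎)
    isolatedRow-▸ {a} a∉S s (yes ws<wa) =
      ≋-trans (·ₚ-▸ _ (𝐭^ (wt w a ℕ.∸ wt w s)) (E s))
              (·ᵥ-cong (≋-trans (𝐭^-▸-·t^ (wt w a ℕ.∸ wt w s) (A s) (wt w s))
                                (≋-reflexive (≡.cong (A s ·t^_) (ℕ.m∸n+n≡m (ℕ.<⇒≤ ws<wa))))))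
    isolatedRow-▸ a∉S s (no _) = ≋-refl

    isolated-expansion : ∀ {a} (a∉S : a ∉ S) → E a ≋ ∑ᵥ S (λ s → isolatedRow a∉S s (wt w s ℕ.<? wt w a) ▸ E s)
    isolated-expansion {a} a∉S = ≋-sym (begin
      ∑ᵥ S (λ s → isolatedRow a∉S s (wt w s ℕ.<? wt w a) ▸ E s)
        ≈⟨ ∑ᵥ-cong S (λ s → isolatedRow-▸ a∉S s (wt w s ℕ.<? wt w a)) ⟩
      ∑ᵥ S (λ s → if does (wt w s ℕ.<? wt w a) then λs s ·ᵥ A s ·t^ wt w a else 𝟎)
        ≈⟨ ∑ᵥ-filter (λ s → wt w s ℕ.<? wt w a) S _ ⟨
      ∑ᵥ (filter (λ s → wt w s ℕ.<? wt w a) S) (λ s → λs s ·ᵥ A s ·t^ wt w a)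
        ≈⟨ sumAlg-·t^ (filter (λ s → wt w s ℕ.<? wt w a) S) λs A (wt w a) ⟨
      sumAlg F (filter (λ s → wt w s ℕ.<? wt w a) S) (λ s i → λs s * A s i) ·t^ wt w a
        ≈⟨ ·t^-cong (wt w a) (λ j → sym (proj₂ (isolate a a∉S) j)) ⟩
      E a ∎)
      where
        open Relation.Binary.Reasoning.Setoid ≋-setoid
        λs : Exp n d → Carrier
        λs = proj₁ (isolate a a∉S)

    ct-isolatedRow : ∀ {a} (a∉S : a ∉ S) s D → ct (isolatedRow a∉S s D) ≈ 0#
    ct-isolatedRow {a} a∉S s (yes ws<wa) =
      trans (coeffT-·ₚ _ (𝐭^ (wt w a ℕ.∸ wt w s)) 0) (trans (*-cong refl (ct-𝐭^-pos (ℕ.m<n⇒0<n∸m ws<wa))) (zeroʳ _))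
    ct-isolatedRow a∉S s (no _) = refl

    basisIsolating⇒IdentityModT : IdentityModT S E E
    basisIsolating⇒IdentityModT = (λ a → row a (a ∈? S)) , (λ a → expand a (a ∈? S)) , (λ a → ct-row a (a ∈? S))
      where
        row : ∀ a → Dec (a ∈ S) → Exp n d → Pol
        row a (yes a∈S)   = Span.coefficient (span-∈ {f = E} uS a∈S)
        row a (no a∉S)  s = isolatedRow a∉S s (wt w s ℕ.<? wt w a)
        expand : ∀ a D → E a ≋ ∑ᵥ S (λ s → row a D s ▸ E s)
        expand a (yes a∈S) = Span.expansion (span-∈ uS a∈S)
        expand a (no a∉S)  = isolated-expansion a∉S
        ct-row : ∀ a D {s} → s ∈ S → ct (row a D s) ≈ δ a s
        ct-row a (yes a∈S) {s} _   = reflexive (δ-sym s a)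
        ct-row a (no a∉S)  {s} s∈S =
          trans (ct-isolatedRow a∉S s (wt w s ℕ.<? wt w a)) (sym (δ-≢ (λ a≡s → a∉S (≡.subst (_∈ S) (≡.sym a≡s) s∈S))))

    basisIsolating⇒concentrated : ∀ L → length S ℕ.< 2 ℕ.^ L → IsConcentrated F L A′
    basisIsolating⇒concentrated L |S|< x =
      span⇒InFtSpan (𝐭^ (wt w x) *ₚ q) (wt w x , nonzero)
        (span-cong (≋-sym (≋-trans (*ₚ-▸ (𝐭^ (wt w x)) q (A′ x)) (▸-comm (𝐭^ (wt w x)) q (A′ x)))) span-x)
      where
        interpolant : ∀ s → Interpolant L S (δ s)
        interpolant s = interpolation n L S (δ s) |S|<
        N : Exp n d → Exp n d → Carrier
        N s = proj₁ (interpolant s)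
        R : IdentityModT S E E
        R = basisIsolating⇒IdentityModT
        open Elimination (gaussian-elimination uS (combine-rows (allExp-unique n d) (λ _ → ∈-allExp _) R
                                                    (λ s → binomSum (N s)) (λ s → proj₂ (proj₂ (interpolant s)))))
          renaming (multiplier to q)
        nonzero : ¬ (coeffT F (𝐭^ (wt w x) *ₚ q) (wt w x) ≈ 0#)
        nonzero ≈0 = 0≉1 (trans (sym ≈0) (trans (coeffT-𝐭^*ₚ (wt w x) q) ct-multiplier))
        span-U : ∀ s → Span (lowSupport L) A′ (∑ᵥ M (λ c → binomSum (N s) c ·ᵥ E c))
        span-U s = span-binomSum (N s) (proj₁ (proj₂ (interpolant s)))
        span-qE : ∀ c → Span (lowSupport L) A′ (q ▸ E c)
        span-qE c = span-trans (span-▸-generators q (proj₁ R c , proj₁ (proj₂ R) c))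
                               (λ s∈S → span-trans (span-multiple s∈S) (λ {s} _ → span-U s))
        expand-x : q ▸ 𝐭^ (wt w x) ▸ A′ x ≋ ∑ᵥ M (λ c → binomProd F c x ·ᵥ q ▸ E c)
        expand-x = ≋-trans (▸-cong q (shift-identity x)) (≋-trans (▸-∑ᵥ q M _) (∑ᵥ-cong M (λ c → ▸-·ᵥ q _ (E c))))
        span-x : Span (lowSupport L) A′ (q ▸ 𝐭^ (wt w x) ▸ A′ x)
        span-x = span-cong (≋-sym expand-x) (span-∑ M (λ {c} _ → span-·ᵥ _ (span-qE c)))

lemma5p2 : ∀ {c ℓ} (F : Field c ℓ) (k n d : ℕ) (A : Poly F k n d) (w : Fin n → ℕ)
    → IsBasisIsolating F A w
    → IsConcentrated F ⌈log₂ (suc k) ⌉ (shift F A w)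
lemma5p2 F k n d A w BI@(_ , _ , |S|≤k , _) =
  Concentration.basisIsolating⇒concentrated F A w BI ⌈log₂ (suc k) ⌉ (ℕ.≤-trans (s≤s |S|≤k) (n≤2^⌈log₂n⌉ (suc k)))
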